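{- Let $G=(\Gamma,R,B)$ be a $2$-edge-coloured graph. If $\mathcal{P}_G=\emptyset$ and $\mathcal{O}_G=\emptyset$, then $G$ is chromatically invariant, i.e. $P(G,\lambda)=P(\Gamma,\lambda)$.
   Context: All graphs are finite and simple. A $2$-edge-coloured graph is a triple $G=(\Gamma,R,B)$ with $R,B\subseteq E(\Gamma)$, $R\cap B=\emptyset$, $R\cup B=E(\Gamma)$ (red and blue edges). A $k$-colouring of $G$ is a proper vertex colouring $c:V(\Gamma)\to\{1,\dots,k\}$ of $\Gamma$ such that for every $ux\in R$ and $vy\in B$ (either endpoint may play the role of $u$, resp. $v$), $c(u)=c(v)$ implies $c(x)\ne c(y)$. $P(G,\lambda)$ is the polynomial with $P(G,k)$ the number of $k$-colourings of $G$ for all non-negative integers $k$; $P(\Gamma,\lambda)$ is the usual chromatic polynomial of $\Gamma$. A bichromatic $2$-path is an induced path $xuy$ of $\Gamma$ (so $xy\notin E(\Gamma)$) with $xu\in R$, $uy\in B$; $\mathcal{P}_G$ is the set of these. Let $\Lambda$ be $\Gamma$ with the edge $xy$ added for every pair $x,y$ that are ends of a bichromatic $2$-path. A red edge $ux\in R$ and blue edge $vy\in B$ are obstructing if the subgraph of $\Lambda$ induced by $\{u,x,v,y\}$ has chromatic number $2$; $\mathcal{O}_G$ is the set of pairs of obstructing edges. -}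

module Defs where

open import Data.Nat using (ℕ; zero; suc; _<_)
open import Data.Fin using (Fin)
open import Data.Fin.Properties using (all?) renaming (_≟_ to _≟F_)
open import Data.List using (List; []; _∷_; concatMap; map; length; filter)
open import Data.List.Base using (allFin)
open import Data.Product using (Σ; _×_; _,_)
open import Data.Sum using (_⊎_)
open import Relation.Nullary using (¬_; Dec; yes; no)
open import Relation.Nullary.Decidable using (_×-dec_; _→-dec_; ¬?)
open import Relation.Binary.PropositionalEquality using (_≡_; _≢_; refl)
import Data.Vec.Functional as VF

data EdgeState : Set where
  none red blue : EdgeState

_≟E_ : (a b : EdgeState) → Dec (a ≡ b)
none ≟E none = yes refl
none ≟E red  = no λ ()
none ≟E blue = no λ ()
red  ≟E none = no λ ()
red  ≟E red  = yes refl
red  ≟E blue = no λ ()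
blue ≟E none = no λ ()
blue ≟E red  = no λ ()
blue ≟E blue = yes refl

-- A finite simple 2-edge-coloured graph G = (Γ, R, B) on vertex set Fin n.
-- E(Γ) = pairs with state ≢ none; R = red pairs; B = blue pairs.
record ECGraph : Set where
  field
    n      : ℕ
    col    : Fin n → Fin n → EdgeState
    sym    : ∀ u v → col u v ≡ col v u
    irrefl : ∀ u → col u u ≡ none

module _ (G : ECGraph) where
  open ECGraph G

  Adj : Fin n → Fin n → Set
  Adj u v = ¬ (col u v ≡ none)

  Red : Fin n → Fin n → Set
  Red u v = col u v ≡ red

  Blue : Fin n → Fin n → Set
  Blue u v = col u v ≡ blue

  Proper : {k : ℕ} → (Fin n → Fin k) → Set
  Proper c = ∀ u v → Adj u v → ¬ (c u ≡ c v)

  IsColouring : {k : ℕ} → (Fin n → Fin k) → Set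
  IsColouring c = Proper c ×
    (∀ u x v y → Red u x → Blue v y → c u ≡ c v → ¬ (c x ≡ c y))

  BichromaticPath : Fin n → Fin n → Fin n → Set
  BichromaticPath x u y = Red x u × Blue u y × ¬ (x ≡ y) × col x y ≡ none

  NoBichromaticPaths : Set
  NoBichromaticPaths = ∀ x u y → ¬ BichromaticPath x u y

  ΛAdj : Fin n → Fin n → Set
  ΛAdj x y = Adj x y ⊎ Σ (Fin n) (λ u → BichromaticPath x u y ⊎ BichromaticPath y u x)

  ΛColourableOn : (Fin n → Set) → ℕ → Set
  ΛColourableOn S j = Σ (Fin n → Fin j) λ c →
    ∀ a b → S a → S b → ΛAdj a b → ¬ (c a ≡ c b)

  ΛChromaticNumberOn : (Fin n → Set) → ℕ → Set
  ΛChromaticNumberOn S m = ΛColourableOn S m × (∀ j → j < m → ¬ ΛColourableOn S j)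

  Quad : Fin n → Fin n → Fin n → Fin n → Fin n → Set
  Quad u x v y a = a ≡ u ⊎ a ≡ x ⊎ a ≡ v ⊎ a ≡ y

  Obstructing : Fin n → Fin n → Fin n → Fin n → Set
  Obstructing u x v y = Red u x × Blue v y × ΛChromaticNumberOn (Quad u x v y) 2

  NoObstructingPairs : Set
  NoObstructingPairs = ∀ u x v y → ¬ Obstructing u x v y

  proper? : {k : ℕ} (c : Fin n → Fin k) → Dec (Proper c)
  proper? c = all? λ u → all? λ v → ¬? (u ≟E' v) →-dec ¬? (c u ≟F c v)
    where _≟E'_ = λ u v → col u v ≟E none

  isColouring? : {k : ℕ} (c : Fin n → Fin k) → Dec (IsColouring c)
  isColouring? c = proper? c ×-dec
    (all? λ u → all? λ x → all? λ v → all? λ y →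
      (col u x ≟E red) →-dec (col v y ≟E blue) →-dec (c u ≟F c v) →-dec ¬? (c x ≟F c y))

allFunctions : (n k : ℕ) → List (Fin n → Fin k)
allFunctions zero    k = (λ ()) ∷ []
allFunctions (suc n) k = concatMap (λ i → map (λ f → i VF.∷ f) (allFunctions n k)) (allFin k)

countFun : (n k : ℕ) {P : (Fin n → Fin k) → Set} → (∀ c → Dec (P c)) → ℕ
countFun n k P? = length (filter P? (allFunctions n k))

chromPolyG : ECGraph → ℕ → ℕ
chromPolyG G k = countFun (ECGraph.n G) k (isColouring? G)

chromPolyΓ : ECGraph → ℕ → ℕ
chromPolyΓ G k = countFun (ECGraph.n G) k (proper? G)

-- Every k-colouring of G is a proper colouring of Γ, so it suffices to show
-- the converse: a proper colouring c of Γ already satisfies the extra red/blue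
-- condition.  Suppose ux is red, vy is blue, c u ≡ c v and c x ≡ c y.  With no
-- bichromatic 2-paths, Λ has the same edges as Γ, so c is proper on Λ; on the
-- four vertices {u,x,v,y} it takes only the two values c u and c x, and hence
-- "has colour c u or not" is a proper 2-colouring of the induced subgraph of Λ.
-- That subgraph contains the edge ux, so its chromatic number is exactly 2 and
-- the pair (ux, vy) is obstructing, a contradiction.
module Submission where

open import Defs
open import Data.Nat using (ℕ; zero; suc; _<_; s≤s)
open import Data.Fin using (Fin) renaming (zero to fzero; suc to fsuc)
open import Data.Fin.Properties using () renaming (_≟_ to _≟F_)
open import Data.Product using (_,_; proj₁)
open import Data.Sum using (_⊎_; inj₁; inj₂)
open import Data.Empty using (⊥-elim)
open import Relation.Nullary using (¬_; Dec; yes; no)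
open import Data.List using (length)
open import Data.List.Properties using (filter-≐)
open import Relation.Binary.PropositionalEquality using (_≡_; _≢_; refl; sym; trans; cong)

countFun-≐ : (n k : ℕ) {P Q : (Fin n → Fin k) → Set}
  (P? : ∀ c → Dec (P c)) (Q? : ∀ c → Dec (Q c)) →
  (∀ c → P c → Q c) → (∀ c → Q c → P c) →
  countFun n k P? ≡ countFun n k Q?
countFun-≐ n k P? Q? P⇒Q Q⇒P =
  cong length (filter-≐ P? Q? ((λ {c} → P⇒Q c) , (λ {c} → Q⇒P c)) (allFunctions n k))

indicator : {A : Set} → Dec A → Fin 2
indicator (yes _) = fzero
indicator (no _)  = fsuc fzero

module _ (G : ECGraph) where
  open ECGraph G using (n; col)

  coloured⇒Adj : ∀ {u x s} → col u x ≡ s → s ≢ none → Adj G u x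
  coloured⇒Adj refl s≢none ux≡none = s≢none ux≡none

  red⇒Adj : ∀ {u x} → Red G u x → Adj G u x
  red⇒Adj r = coloured⇒Adj r λ ()

  Λ⇒Adj : NoBichromaticPaths G → ∀ a b → ΛAdj G a b → Adj G a b
  Λ⇒Adj noP a b (inj₁ ab)              = ab
  Λ⇒Adj noP a b (inj₂ (w , inj₁ awb)) = ⊥-elim (noP a w b awb)
  Λ⇒Adj noP a b (inj₂ (w , inj₂ bwa)) = ⊥-elim (noP b w a bwa)

  -- A 2-colourable induced subgraph of Λ containing an edge has chromatic
  -- number exactly 2: 0 colours fail on a vertex, 1 colour fails on the edge.
  chromaticNumberTwo : {S : Fin n → Set} {a b : Fin n} → S a → S b →
    ΛAdj G a b → ΛColourableOn G S 2 → ΛChromaticNumberOn G S 2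
  chromaticNumberTwo {S} {a} {b} Sa Sb ab two = two , fewer
    where
    fewer : ∀ j → j < 2 → ¬ ΛColourableOn G S j
    fewer zero          _ (d , _)  with d a
    ... | ()
    fewer (suc zero)    _ (d , ok) = ok a b Sa Sb ab (single (d a) (d b))
      where
      single : (i j : Fin 1) → i ≡ j
      single fzero fzero = refl
    fewer (suc (suc _)) (s≤s (s≤s ()))

  -- A colouring that is proper on the induced subgraph of Λ on S and takes
  -- at most two values p, q there yields a 2-colouring: "has colour p or not".
  twoValued⇒2colourable : {k : ℕ} {S : Fin n → Set} (c : Fin n → Fin k) (p q : Fin k) →
    (∀ a b → S a → S b → ΛAdj G a b → c a ≢ c b) →
    (∀ a → S a → c a ≡ p ⊎ c a ≡ q) →
    ΛColourableOn G S 2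
  twoValued⇒2colourable {S = S} c p q proper values = d , d-proper
    where
    d : Fin n → Fin 2
    d a = indicator (c a ≟F p)

    sameSide : ∀ {a b} → S a → S b →
      (pa : Dec (c a ≡ p)) (pb : Dec (c b ≡ p)) → indicator pa ≡ indicator pb → c a ≡ c b
    sameSide _  _  (yes a≡p) (yes b≡p) _ = trans a≡p (sym b≡p)
    sameSide {a} {b} Sa Sb (no a≢p) (no b≢p) _ with values a Sa | values b Sb
    ... | inj₁ a≡p | _        = ⊥-elim (a≢p a≡p)
    ... | _        | inj₁ b≡p = ⊥-elim (b≢p b≡p)
    ... | inj₂ a≡q | inj₂ b≡q = trans a≡q (sym b≡q)
    sameSide _  _  (yes _) (no _)  ()
    sameSide _  _  (no _)  (yes _) ()

    d-proper : ∀ a b → S a → S b → ΛAdj G a b → d a ≢ d b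
    d-proper a b Sa Sb ab da≡db =
      proper a b Sa Sb ab (sameSide Sa Sb (c a ≟F p) (c b ≟F p) da≡db)

  quadValues : {k : ℕ} (c : Fin n → Fin k) {u x v y : Fin n} →
    c u ≡ c v → c x ≡ c y → ∀ a → Quad G u x v y a → c a ≡ c u ⊎ c a ≡ c x
  quadValues c uv xy a (inj₁ refl)                = inj₁ refl
  quadValues c uv xy a (inj₂ (inj₁ refl))         = inj₂ refl
  quadValues c uv xy a (inj₂ (inj₂ (inj₁ refl)))  = inj₁ (sym uv)
  quadValues c uv xy a (inj₂ (inj₂ (inj₂ refl)))  = inj₂ (sym xy)

  -- The key step: under the hypotheses, every proper colouring of Γ is a
  -- colouring of G, since a violated red/blue pair would be obstructing.
  proper⇒colouring : NoBichromaticPaths G → NoObstructingPairs G →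
    {k : ℕ} (c : Fin n → Fin k) → Proper G c → IsColouring G c
  proper⇒colouring noP noO c proper = proper , redBlue
    where
    redBlue : ∀ u x v y → Red G u x → Blue G v y → c u ≡ c v → c x ≢ c y
    redBlue u x v y r b uv xy = noO u x v y (r , b , chromaticNumberTwo
      (inj₁ refl) (inj₂ (inj₁ refl)) (inj₁ (red⇒Adj r))
      (twoValued⇒2colourable c (c u) (c x)
        (λ a b _ _ ab → proper a b (Λ⇒Adj noP a b ab))
        (quadValues c uv xy)))

lemma6 : (G : ECGraph) → NoBichromaticPaths G → NoObstructingPairs G →
    (k : ℕ) → chromPolyG G k ≡ chromPolyΓ G k
lemma6 G noP noO k = countFun-≐ (ECGraph.n G) k (isColouring? G) (proper? G)
  (λ c → proj₁) (proper⇒colouring G noP noO)
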